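{- Let $K$ be an algebraically closed field of characteristic not $2$. The algebraic set $P_{1,a}$ is nonsingular for every $a\in K$, and the algebraic set $P_{2,a}$ is nonsingular for every $a\in K\setminus\{ -1/4\}$.
   Context: $f_c(x)=x^2+c$, $f_c^N$ its $N$-th iterate, viewed with $c$ an indeterminate. For $a\in K$, $P_{N,a}\subset\mathbb{A}^2$ (coordinates $(x,c)$) is the algebraic set defined by $f_c^N(x)-a=0$. -}

module Defs where

open import Level using (_⊔_)
open import Data.Nat using (ℕ; zero; suc)
open import Data.Vec using (Vec; foldr)
open import Data.Product using (∃; _×_)
open import Relation.Nullary using (¬_)
open import Data.Empty using (⊥)
open import Algebra.Bundles using (CommutativeRing)

module _ {c ℓ} (R : CommutativeRing c ℓ) where
  open CommutativeRing R

  IsField : Set (c ⊔ ℓ)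
  IsField = (¬ (0# ≈ 1#)) × (∀ x → ¬ (x ≈ 0#) → ∃ λ y → x * y ≈ 1#)

  CharNot2 : Set ℓ
  CharNot2 = ¬ (1# + 1# ≈ 0#)

  -- Horner evaluation of a_0 + a_1 t + ... + a_n t^n, coefficients listed a_0 first.
  evalCoeffs : ∀ {n} → Vec Carrier n → Carrier → Carrier
  evalCoeffs as t = foldr _ (λ a acc → a + t * acc) 0# as

  power : Carrier → ℕ → Carrier
  power t zero = 1#
  power t (suc n) = t * power t n

  AlgClosed : Set (c ⊔ ℓ)
  AlgClosed = ∀ n (as : Vec Carrier (suc n)) →
              ∃ λ t → power t (suc n) + evalCoeffs as t ≈ 0#

  -- Polynomials in K[x,c], given by expressions.
  data Poly : Set c where
    X   : Poly
    C   : Poly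
    con : Carrier → Poly
    _⊕_ : Poly → Poly → Poly
    _⊗_ : Poly → Poly → Poly

  eval : Poly → Carrier → Carrier → Carrier
  eval X       x y = x
  eval C       x y = y
  eval (con k) x y = k
  eval (p ⊕ q) x y = eval p x y + eval q x y
  eval (p ⊗ q) x y = eval p x y * eval q x y

  ∂x : Poly → Poly
  ∂x X       = con 1#
  ∂x C       = con 0#
  ∂x (con k) = con 0#
  ∂x (p ⊕ q) = ∂x p ⊕ ∂x q
  ∂x (p ⊗ q) = (∂x p ⊗ q) ⊕ (p ⊗ ∂x q)

  ∂c : Poly → Poly
  ∂c X       = con 0#
  ∂c C       = con 1#
  ∂c (con k) = con 0#
  ∂c (p ⊕ q) = ∂c p ⊕ ∂c q
  ∂c (p ⊗ q) = (∂c p ⊗ q) ⊕ (p ⊗ ∂c q)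

  fIter : ℕ → Poly
  fIter zero    = X
  fIter (suc N) = (fIter N ⊗ fIter N) ⊕ C

  Pdef : ℕ → Carrier → Poly
  Pdef N a = fIter N ⊕ con (- a)

  Nonsingular : Poly → Set (c ⊔ ℓ)
  Nonsingular F = ∀ x y → eval F x y ≈ 0# →
                  eval (∂x F) x y ≈ 0# → eval (∂c F) x y ≈ 0# → ⊥

{-# OPTIONS --safe #-}
module Submission where

-- The c-derivative of f_c^2(x) - a is 2G + 1 with G = x^2 + c, and the x-derivative is 4xG.
-- At a singular point G = -1/2, so G ≠ 0 and hence x = 0; then c = -1/2 and
-- completing the square, 4(G^2 + G) = (2G + 1)^2 - 1, forces a = c^2 + c = -1/4.
-- For N = 1 the c-derivative is the constant 1, so there are no singular points at all.

open import Defs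
open import Data.Product using (∃; _×_; _,_)
open import Relation.Nullary using (¬_)
open import Algebra.Bundles using (CommutativeRing)
import Algebra.Properties.Ring as RingProperties

module _ {c ℓ} (K : CommutativeRing c ℓ) where
  open CommutativeRing K
  open RingProperties ring using (-‿involutive)
  open import Algebra.Solver.Ring.NaturalCoefficients.Default commutativeSemiring
    using (solve; _:+_; _:*_; con; _:=_)

  private
    two four : Carrier
    two  = 1# + 1#
    four = 1# + 1# + 1# + 1#

    G : Carrier → Carrier → Carrier
    G x y = x * x + y

  x≉0∧x*y≈0⇒y≈0 : (∀ x → ¬ (x ≈ 0#) → ∃ λ x⁻¹ → x * x⁻¹ ≈ 1#) →
                  ∀ {x y} → ¬ (x ≈ 0#) → x * y ≈ 0# → y ≈ 0#
  x≉0∧x*y≈0⇒y≈0 inverse {x} {y} x≉0 x*y≈0 with inverse x x≉0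
  ... | x⁻¹ , x*x⁻¹≈1 = begin
    y               ≈⟨ *-identityˡ y ⟨
    1# * y          ≈⟨ *-congʳ x*x⁻¹≈1 ⟨
    (x * x⁻¹) * y   ≈⟨ solve 3 (λ x x⁻¹ y → (x :* x⁻¹) :* y := x⁻¹ :* (x :* y)) refl x x⁻¹ y ⟩
    x⁻¹ * (x * y)   ≈⟨ *-congˡ x*y≈0 ⟩
    x⁻¹ * 0#        ≈⟨ zeroʳ x⁻¹ ⟩
    0#              ∎
    where open import Relation.Binary.Reasoning.Setoid setoid

  eval-∂c-Pdef₁ : ∀ a x y → eval K (∂c K (Pdef K 1 a)) x y ≈ 1#
  eval-∂c-Pdef₁ a = solve 2 (λ x y → ((con 0 :* x :+ x :* con 0) :+ con 1) :+ con 0 := con 1) refl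

  eval-∂c-Pdef₂ : ∀ a x y → eval K (∂c K (Pdef K 2 a)) x y ≈ two * G x y + 1#
  eval-∂c-Pdef₂ a = solve 2 (λ x y →
    let ∂G = (con 0 :* x :+ x :* con 0) :+ con 1 ; G = x :* x :+ y in
    ((∂G :* G :+ G :* ∂G) :+ con 1) :+ con 0 := con 2 :* G :+ con 1) refl

  eval-∂x-Pdef₂ : ∀ a x y → eval K (∂x K (Pdef K 2 a)) x y ≈ two * (two * (x * G x y))
  eval-∂x-Pdef₂ a = solve 2 (λ x y →
    let ∂G = (con 1 :* x :+ x :* con 1) :+ con 0 ; G = x :* x :+ y in
    ((∂G :* G :+ G :* ∂G) :+ con 0) :+ con 0 := con 2 :* (con 2 :* (x :* G))) refl

  -- The variables x, y, b stand for x, c, -a, so no subtraction occurs and this is a semiring identity.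
  four*b+[2G+1]²≈four*Pdef₂+four*x²+1 : ∀ x y b →
    four * b + (two * G x y + 1#) * (two * G x y + 1#)
      ≈ four * ((G x y * G x y + y) + b) + four * (x * x) + 1#
  four*b+[2G+1]²≈four*Pdef₂+four*x²+1 = solve 3 (λ x y b →
    let G = x :* x :+ y in
    con 4 :* b :+ (con 2 :* G :+ con 1) :* (con 2 :* G :+ con 1)
      := con 4 :* ((G :* G :+ y) :+ b) :+ con 4 :* (x :* x) :+ con 1) refl

  P₁-nonsingular : ¬ (0# ≈ 1#) → ∀ a → Nonsingular K (Pdef K 1 a)
  P₁-nonsingular 0≉1 a x y _ _ ∂cF≈0 = 0≉1 (trans (sym ∂cF≈0) (eval-∂c-Pdef₁ a x y))

  P₂-singular⇒four*[-a]≈1 : IsField K → CharNot2 K → ∀ a x y →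
    eval K (Pdef K 2 a) x y ≈ 0# → eval K (∂x K (Pdef K 2 a)) x y ≈ 0# →
    eval K (∂c K (Pdef K 2 a)) x y ≈ 0# → four * (- a) ≈ 1#
  P₂-singular⇒four*[-a]≈1 (0≉1 , inverse) two≉0 a x y F≈0 ∂xF≈0 ∂cF≈0 = begin
    four * (- a)                                 ≈⟨ solve 1 (λ b → con 4 :* b :+ con 0 :* con 0 := con 4 :* b) refl (- a) ⟨
    four * (- a) + 0# * 0#                       ≈⟨ +-congˡ (*-cong 2G+1≈0 2G+1≈0) ⟨
    four * (- a) + (two * G x y + 1#) * (two * G x y + 1#)
                                                 ≈⟨ four*b+[2G+1]²≈four*Pdef₂+four*x²+1 x y (- a) ⟩
    four * eval K (Pdef K 2 a) x y + four * (x * x) + 1#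
                                                 ≈⟨ +-congʳ (+-cong (*-congˡ F≈0) (*-congˡ (*-cong x≈0 x≈0))) ⟩
    four * 0# + four * (0# * 0#) + 1#            ≈⟨ solve 0 (con 4 :* con 0 :+ con 4 :* (con 0 :* con 0) :+ con 1 := con 1) refl ⟩
    1#                                           ∎
    where
    open import Relation.Binary.Reasoning.Setoid setoid

    cancel : ∀ {x y} → ¬ (x ≈ 0#) → x * y ≈ 0# → y ≈ 0#
    cancel = x≉0∧x*y≈0⇒y≈0 inverse

    2G+1≈0 : two * G x y + 1# ≈ 0#
    2G+1≈0 = trans (sym (eval-∂c-Pdef₂ a x y)) ∂cF≈0

    G≉0 : ¬ (G x y ≈ 0#)
    G≉0 G≈0 = 0≉1 (begin
      0#               ≈⟨ 2G+1≈0 ⟨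
      two * G x y + 1# ≈⟨ +-congʳ (*-congˡ G≈0) ⟩
      two * 0# + 1#    ≈⟨ solve 0 (con 2 :* con 0 :+ con 1 := con 1) refl ⟩
      1#               ∎)

    x*G≈0 : x * G x y ≈ 0#
    x*G≈0 = cancel two≉0 (cancel two≉0 (trans (sym (eval-∂x-Pdef₂ a x y)) ∂xF≈0))

    x≈0 : x ≈ 0#
    x≈0 = cancel G≉0 (trans (*-comm (G x y) x) x*G≈0)

  P₂-nonsingular : IsField K → CharNot2 K →
    ∀ a → (∀ q → four * q ≈ 1# → ¬ (a ≈ - q)) → Nonsingular K (Pdef K 2 a)
  P₂-nonsingular isField two≉0 a a≉-q x y F≈0 ∂xF≈0 ∂cF≈0 =
    a≉-q (- a) (P₂-singular⇒four*[-a]≈1 isField two≉0 a x y F≈0 ∂xF≈0 ∂cF≈0) (sym (-‿involutive a))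

corollary2p4 : ∀ {c ℓ} (K : CommutativeRing c ℓ) →
    IsField K → AlgClosed K → CharNot2 K →
    let open CommutativeRing K in
    (∀ a → Nonsingular K (Pdef K 1 a))
    × (∀ a → (∀ q → (1# + 1# + 1# + 1#) * q ≈ 1# → ¬ (a ≈ - q)) →
    Nonsingular K (Pdef K 2 a))
corollary2p4 K isField@(0≉1 , _) _ two≉0 =
  P₁-nonsingular K 0≉1 , P₂-nonsingular K isField two≉0
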